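{- Let $G$ be a finite connected chordal graph, let $X \subseteq V(G)$ be a clique of $G$, and let $P$ be a detour of $G$. If $P$ has an end vertex in $X$, or $P$ contains an edge with both end vertices in $X$, then $P$ contains every vertex of $X$.
   Context: A graph is chordal if every cycle on four or more vertices has a chord. A detour of $G$ is a longest path of $G$, i.e. a path with the maximum number of vertices among all paths in $G$. -}

module Defs where

open import Data.Nat using (ℕ; zero; suc; _+_; _≤_; _<_)
open import Data.Fin using (Fin; toℕ)
open import Data.Product using (Σ; _×_; _,_; ∃; ∃-syntax)
open import Data.Sum using (_⊎_)
open import Relation.Binary.PropositionalEquality using (_≡_; _≢_)
open import Relation.Nullary using (¬_)
open import Function.Definitions using (Injective)

record Graph (n : ℕ) : Set₁ where
  field
    Adj   : Fin n → Fin n → Set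
    irrefl : ∀ {u} → ¬ Adj u u
    sym   : ∀ {u v} → Adj u v → Adj v u
open Graph public

record Path {n : ℕ} (G : Graph n) (k : ℕ) : Set where
  field
    vtx      : Fin k → Fin n
    distinct : Injective _≡_ _≡_ vtx
    adjacent : ∀ (i j : Fin k) → suc (toℕ i) ≡ toℕ j → Adj G (vtx i) (vtx j)
open Path public

CycNext : (k : ℕ) → ℕ → ℕ → Set
CycNext k i j = (suc i ≡ j) ⊎ ((suc i ≡ k) × (j ≡ 0))

record Cycle {n : ℕ} (G : Graph n) (k : ℕ) : Set where
  field
    cvtx      : Fin k → Fin n
    cdistinct : Injective _≡_ _≡_ cvtx
    cadjacent : ∀ (i j : Fin k) → CycNext k (toℕ i) (toℕ j) → Adj G (cvtx i) (cvtx j)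
open Cycle public

HasChord : ∀ {n} {G : Graph n} {k} → Cycle G k → Set
HasChord {G = G} {k} C =
  ∃[ i ] ∃[ j ] (Adj G (cvtx C i) (cvtx C j)
    × ¬ CycNext k (toℕ i) (toℕ j) × ¬ CycNext k (toℕ j) (toℕ i))

Chordal : ∀ {n} → Graph n → Set
Chordal G = ∀ k → 4 ≤ k → (C : Cycle G k) → HasChord C

Connected : ∀ {n} → Graph n → Set
Connected {n} G = ∀ (u v : Fin n) → ∃[ k ] Σ (Path G (suc k)) λ P →
  (vtx P Data.Fin.zero ≡ u) × (vtx P (Data.Fin.fromℕ k) ≡ v)

Clique : ∀ {n} → Graph n → (Fin n → Set) → Set
Clique {n} G X = ∀ (u v : Fin n) → X u → X v → u ≢ v → Adj G u v

Detour : ∀ {n} (G : Graph n) {k} → Path G k → Set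
Detour G {k} P = ∀ m → Path G m → m ≤ k

OnPath : ∀ {n} {G : Graph n} {k} → Path G k → Fin n → Set
OnPath P v = ∃[ i ] vtx P i ≡ v

EndIn : ∀ {n} {G : Graph n} {k} → Path G k → (Fin n → Set) → Set
EndIn {k = k} P X = ∃[ i ] ((toℕ i ≡ 0) ⊎ (suc (toℕ i) ≡ k)) × X (vtx P i)

EdgeIn : ∀ {n} {G : Graph n} {k} → Path G k → (Fin n → Set) → Set
EdgeIn P X = ∃[ i ] ∃[ j ] (suc (toℕ i) ≡ toℕ j) × X (vtx P i) × X (vtx P j)

-- If some vertex x of the clique X were missing from the detour P, then x could be
-- added to P: in front of an end vertex of P lying in X, or between the two ends
-- of an edge of P inside X, since x is adjacent to every other vertex of X.  This
-- gives a path longer than the longest one.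
module Submission where

open import Defs
open import Data.Nat using (ℕ; zero; suc; _<_; s≤s)
open import Data.Nat.Properties using (suc-injective; ≤-reflexive; 1+n≢n; 1+n≰n; <-irrefl)
open import Data.Fin using (Fin; zero; suc; toℕ; fromℕ; inject₁; punchOut)
open import Data.Fin.Properties
  using (_≟_; toℕ-injective; toℕ<n; toℕ-fromℕ; toℕ-inject₁; punchOut-injective; any?)
open import Data.Product using (∃; _,_)
open import Data.Sum using (_⊎_; inj₁; inj₂)
open import Data.Empty using (⊥-elim)
open import Function using (_∘_)
open import Relation.Nullary using (¬_; yes; no; contradiction)
open import Relation.Binary.PropositionalEquality as ≡
  using (_≡_; _≢_; refl; trans; cong; subst)

toℕ-punchOut-< : ∀ {n} {i j : Fin (suc n)} (i≢j : i ≢ j) →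
  toℕ j < toℕ i → toℕ (punchOut i≢j) ≡ toℕ j
toℕ-punchOut-< {suc _} {suc i} {zero}  _   _         = refl
toℕ-punchOut-< {suc _} {suc i} {suc j} i≢j (s≤s j<i) =
  cong suc (toℕ-punchOut-< (i≢j ∘ cong suc) j<i)

suc-toℕ-punchOut-> : ∀ {n} {i j : Fin (suc n)} (i≢j : i ≢ j) →
  toℕ i < toℕ j → suc (toℕ (punchOut i≢j)) ≡ toℕ j
suc-toℕ-punchOut-> {_}     {zero}  {suc j} _   _ = refl
suc-toℕ-punchOut-> {suc _} {suc i} {suc j} i≢j (s≤s i<j) =
  cong suc (suc-toℕ-punchOut-> (i≢j ∘ cong suc) i<j)

punchOut-consecutive : ∀ {n} {m i j : Fin (suc n)} (m≢i : m ≢ i) (m≢j : m ≢ j) →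
  suc (toℕ i) ≡ toℕ j → suc (toℕ (punchOut m≢i)) ≡ toℕ (punchOut m≢j)
punchOut-consecutive {_} {zero} {zero} m≢i _ _ = contradiction refl m≢i
punchOut-consecutive {_} {zero} {suc i} {suc j} _ _ e = suc-injective e
punchOut-consecutive {suc _} {suc zero} {zero} {suc zero} _ m≢j _ = contradiction refl m≢j
punchOut-consecutive {suc (suc _)} {suc (suc m)} {zero} {suc zero} _ _ _ = refl
punchOut-consecutive {suc _} {suc m} {suc i} {suc j} m≢i m≢j e =
  cong suc (punchOut-consecutive (m≢i ∘ cong suc) (m≢j ∘ cong suc) (suc-injective e))

module _ {n} {G : Graph n} {k} (P : Path G k) {x : Fin n} (x∉P : ¬ OnPath P x)
         (m : Fin (suc k))
         (before : ∀ i → suc (toℕ i) ≡ toℕ m → Adj G (vtx P i) x)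
         (after : ∀ i → toℕ i ≡ toℕ m → Adj G x (vtx P i)) where

  private
    insertVtx : Fin (suc k) → Fin n
    insertVtx j with m ≟ j
    ... | yes _   = x
    ... | no m≢j = vtx P (punchOut m≢j)

    insertVtx-injective : ∀ {i j} → insertVtx i ≡ insertVtx j → i ≡ j
    insertVtx-injective {i} {j} e with m ≟ i | m ≟ j
    ... | yes refl | yes refl = refl
    ... | yes refl | no m≢j  = ⊥-elim (x∉P (punchOut m≢j , ≡.sym e))
    ... | no m≢i  | yes refl = ⊥-elim (x∉P (punchOut m≢i , e))
    ... | no m≢i  | no m≢j  = punchOut-injective m≢i m≢j (distinct P e)

    insertVtx-adjacent : ∀ i j → suc (toℕ i) ≡ toℕ j → Adj G (insertVtx i) (insertVtx j)
    insertVtx-adjacent i j e with m ≟ i | m ≟ j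
    ... | yes refl | yes refl = contradiction e 1+n≢n
    ... | yes refl | no m≢j  =
      after (punchOut m≢j) (suc-injective (trans (suc-toℕ-punchOut-> m≢j (≤-reflexive e)) (≡.sym e)))
    ... | no m≢i  | yes refl =
      before (punchOut m≢i) (trans (cong suc (toℕ-punchOut-< m≢i (≤-reflexive e))) e)
    ... | no m≢i  | no m≢j  = adjacent P _ _ (punchOut-consecutive m≢i m≢j e)

  insert : Path G (suc k)
  insert = record
    { vtx      = insertVtx
    ; distinct = insertVtx-injective
    ; adjacent = insertVtx-adjacent
    }

module _ {n} {G : Graph n} {k} (P : Path G k) (X : Fin n → Set) where

  -- Inserting at slot m places a vertex between positions m - 1 and m of P.
  SlotIn : Fin (suc k) → Set
  SlotIn m = ∀ i → suc (toℕ i) ≡ toℕ m ⊎ toℕ i ≡ toℕ m → X (vtx P i)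

  private
    X-at : ∀ {i j} → toℕ i ≡ toℕ j → X (vtx P j) → X (vtx P i)
    X-at e = subst (X ∘ vtx P) (toℕ-injective (≡.sym e))

  end⊎edge⇒slot : EndIn P X ⊎ EdgeIn P X → ∃ SlotIn
  end⊎edge⇒slot (inj₁ (i , inj₁ first , Xi)) = zero , λ
    { i′ (inj₁ ())
    ; i′ (inj₂ e) → X-at (trans e (≡.sym first)) Xi }
  end⊎edge⇒slot (inj₁ (i , inj₂ last , Xi)) = fromℕ k , λ
    { i′ (inj₁ e) → X-at (suc-injective (trans e (trans (toℕ-fromℕ k) (≡.sym last)))) Xi
    ; i′ (inj₂ e) → ⊥-elim (<-irrefl (trans e (toℕ-fromℕ k)) (toℕ<n i′)) }
  end⊎edge⇒slot (inj₂ (i , j , e , Xi , Xj)) = inject₁ j , λ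
    { i′ (inj₁ e′) → X-at (suc-injective (trans e′ (trans (toℕ-inject₁ j) (≡.sym e)))) Xi
    ; i′ (inj₂ e′) → X-at (trans e′ (toℕ-inject₁ j)) Xj }

insert-clique : ∀ {n} {G : Graph n} {X : Fin n → Set} → Clique G X →
  ∀ {k} (P : Path G k) {x} → ¬ OnPath P x → X x → ∃ (SlotIn P X) → Path G (suc k)
insert-clique clique P x∉P Xx (m , inX) = insert P x∉P m
  (λ i e → clique _ _ (inX i (inj₁ e)) Xx (x∉P ∘ (i ,_)))
  (λ i e → clique _ _ Xx (inX i (inj₂ e)) (x∉P ∘ (i ,_) ∘ ≡.sym))

proposition1 : ∀ {n : ℕ} (G : Graph n) → Connected G → Chordal G →
    (X : Fin n → Set) → Clique G X →
    ∀ {k} (P : Path G k) → Detour G P →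
    (EndIn P X ⊎ EdgeIn P X) →
    ∀ (x : Fin n) → X x → OnPath P x
proposition1 G _ _ X clique {k} P detour endOrEdge x Xx with any? (λ i → vtx P i ≟ x)
... | yes x∈P = x∈P
... | no x∉P  = contradiction (detour _ longer) 1+n≰n
  where
  longer : Path G (suc k)
  longer = insert-clique clique P x∉P Xx (end⊎edge⇒slot P X endOrEdge)
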